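{- Let $G=(V,V_{\mathrm{red}},E,\mathcal R)$ be a Muller game and let $\sigma\in\{\mathrm{Red},\mathrm{Blue}\}$. Then $W_{G,\sigma}\neq\emptyset$ if and only if $\sigma$ has a winning strategy in the trap-depth game on $G$ in which $\sigma$ goes first. Moreover, if $X$ is the first move of any winning strategy of $\sigma$ in the trap-depth game on $G$ in which $\sigma$ goes first, then $X\subseteq W_{G,\sigma}$.
   Context: A Muller game $G=(V,V_{\mathrm{red}},E,\mathcal R)$ consists of a finite directed graph $(V,E)$ in which every vertex has an outgoing edge, a set $V_{\mathrm{red}}\subseteq V$ of red vertices (the rest, $V_{\mathrm{blue}}=V\setminus V_{\mathrm{red}}$, are blue), and a family $\mathcal R\subseteq 2^V$. Two players, Red and Blue, move a token along edges, the owner of the current vertex choosing the next vertex; starting from a vertex this yields an infinite play $P=(v_0,v_1,\dots)$, and Red wins $P$ iff the set $\mathrm{inf}(P)$ of vertices occurring infinitely often lies in $\mathcal R$; otherwise Blue wins. Strategies may depend on the whole history. $W_{G,\sigma}$ (the winning region of $\sigma$) is the set of vertices from which $\sigma$ has a winning strategy. For a player $\sigma$, $\overline\sigma$ denotes the other player, $V_\sigma$ its vertices, and $R_\sigma=\mathcal R$ if $\sigma$ is Red and $R_\sigma=2^V\setminus\mathcal R$ if $\sigma$ is Blue. A $\sigma$-trap is a set $X\subseteq V$ such that every $x\in X\cap V_\sigma$ has all its successors in $X$, and every $x\in X\cap V_{\overline\sigma}$ has at least one successor in $X$. $\mathrm{Traps}_\sigma(G)$ is the set of nonempty $\sigma$-traps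 of $G$. For $X\subseteq V$, $G[X]$ is the game induced on $X$ (vertices $X$, edges $E\cap X^2$, same ownership, same winning family restricted to subsets of $X$). The trap-depth game on $G$ in which $\sigma$ goes first: set $G_1=G$; in round $i\ge1$, $\sigma$ chooses $X_i\in\mathrm{Traps}_{\overline\sigma}(G_i)$ with $X_i\in R_\sigma$, then $\overline\sigma$ chooses $Y_i\in\mathrm{Traps}_\sigma(G_i[X_i])$ with $Y_i\in R_{\overline\sigma}$, and $G_{i+1}=G_i[Y_i]$. The first player who has no legal move loses. -}

module Defs where

open import Level using (0ℓ)
open import Data.Nat using (ℕ; zero; suc; _≤_)
open import Data.Fin using (Fin)
open import Data.Fin.Subset using (Subset; _∈_; _⊆_; Nonempty)
open import Data.List using (List; map; upTo)
open import Data.Product using (Σ; _×_; _,_; proj₁)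
open import Relation.Nullary using (¬_)
open import Relation.Binary.PropositionalEquality using (_≡_; _≢_)
open import Function.Bundles using (_⇔_)

data Player : Set where
  Red Blue : Player

opponent : Player → Player
opponent Red  = Blue
opponent Blue = Red

record MullerGame (n : ℕ) : Set₁ where
  field
    owner : Fin n → Player
    E     : Fin n → Fin n → Set
    total : ∀ v → Σ (Fin n) (E v)
    ℛ     : Subset n → Set

module _ {n : ℕ} (G : MullerGame n) where
  open MullerGame G

  InR : Player → Subset n → Set
  InR Red  S = ℛ S
  InR Blue S = ¬ ℛ S

  IsPlay : (ℕ → Fin n) → Set
  IsPlay p = ∀ i → E (p i) (p (suc i))

  -- history strictly before position i : (p 0, …, p (i-1))
  prefix : (ℕ → Fin n) → ℕ → List (Fin n)
  prefix p i = map p (upTo i)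

  Strategy : Player → Set
  Strategy σ = (h : List (Fin n)) (v : Fin n) → owner v ≡ σ → Σ (Fin n) (E v)

  ConsistentWith : (σ : Player) → Strategy σ → (ℕ → Fin n) → Set
  ConsistentWith σ str p =
    ∀ i → (o : owner (p i) ≡ σ) → p (suc i) ≡ proj₁ (str (prefix p i) (p i) o)

  InfOften : (ℕ → Fin n) → Fin n → Set
  InfOften p v = ∀ m → Σ ℕ λ k → m ≤ k × p k ≡ v

  IsInfSet : (ℕ → Fin n) → Subset n → Set
  IsInfSet p S = ∀ v → (v ∈ S) ⇔ InfOften p v

  WinsPlay : Player → (ℕ → Fin n) → Set
  WinsPlay σ p = Σ (Subset n) λ S → IsInfSet p S × InR σ S

  WinningStrategyFrom : (σ : Player) → Strategy σ → Fin n → Set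
  WinningStrategyFrom σ str v =
    ∀ (p : ℕ → Fin n) → p 0 ≡ v → IsPlay p → ConsistentWith σ str p → WinsPlay σ p

  InWinningRegion : Player → Fin n → Set
  InWinningRegion σ v = Σ (Strategy σ) λ str → WinningStrategyFrom σ str v

  IsTrapIn : Player → Subset n → Subset n → Set
  IsTrapIn τ S X =
    Nonempty X × X ⊆ S ×
    (∀ x → x ∈ X →
      (owner x ≡ τ → ∀ y → E x y → y ∈ S → y ∈ X) ×
      (owner x ≢ τ → Σ (Fin n) λ y → E x y × y ∈ X))

  -- The trap-depth game; positions are vertex sets S (the game G[S]).

  LegalFirst : Player → Subset n → Subset n → Set
  LegalFirst σ S X = IsTrapIn (opponent σ) S X × InR σ X

  -- σ̄ may answer Y in G[S][X] = G[X]
  LegalSecond : Player → Subset n → Subset n → Set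
  LegalSecond σ X Y = IsTrapIn σ X Y × InR (opponent σ) Y

  -- Every play of this game is finite
  -- (a position never repeats), so winning strategies are exactly
  -- the well-founded trees below.
  data TDWin (σ : Player) (S : Subset n) : Set where
    move : (X : Subset n) → LegalFirst σ S X →
           (∀ Y → LegalSecond σ X Y → TDWin σ Y) → TDWin σ S

  WinningFirstMove : Player → Subset n → Subset n → Set
  WinningFirstMove σ S X =
    LegalFirst σ S X × (∀ Y → LegalSecond σ X Y → TDWin σ Y)

-- The core is an induction over subgames G[S] in the style of McNaughton and Zielonka:
-- if σ̄ loses the trap-depth game on G[S] (σ̄ moving first), then σ wins every play of G[S]
-- with one memory strategy. If S ∉ R_σ, σ̄ may play S itself, so σ has an answer Y ⊂ S,
-- Y ∈ R_σ, on which σ̄ still loses; σ wins on Y and, by induction, on the part of S that σ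
-- cannot force into Y, and attracts to Y everywhere else. If S ∈ R_σ, σ cycles through the
-- vertices d of S, attracting to d and otherwise playing the inductive strategy on the part
-- of S that σ cannot force to d: either every phase ends, so every vertex of S is visited
-- infinitely often and inf = S ∈ R_σ, or the play stays for ever where σ wins by induction.
-- A winning first move X of σ leaves σ̄ losing on G[X], so σ wins from all of X; conversely if
-- σ loses the trap-depth game, σ̄ wins from everywhere, and plays cannot be won by both.
module Submission where

open import Defs
open import Level using (0ℓ)
open import Data.Nat using (ℕ)
open import Data.Fin using (Fin)
open import Data.Fin.Subset using (Subset; _∈_; ⊤)
open import Data.Product using (Σ; _×_)
open import Function.Bundles using (_⇔_)
open import Axiom.ExcludedMiddle using (ExcludedMiddle)

open import Level using () renaming (suc to lsuc)
open import Axiom.UniquenessOfIdentityProofs.WithK using (uip)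
open import Data.Bool using (if_then_else_)
open import Data.Empty using (⊥-elim)
open import Data.Fin using (zero; suc; toℕ)
open import Data.Fin.Properties using (nonZeroIndex; toℕ-injective; toℕ-fromℕ<; toℕ<n)
open import Data.Fin.Subset using (_∉_; _⊆_; _⊂_; Nonempty; Empty)
open import Data.Fin.Subset.Induction using (⊂-wellFounded)
open import Data.Fin.Subset.Properties using (∈⊤; ⊆-antisym)
open import Data.List using (List; []; [_]; _∷ʳ_; foldl; map; upTo)
open import Data.List.Properties using (foldl-∷ʳ; upTo-∷ʳ; map-++)
open import Data.Nat using (zero; suc; _+_; _*_; _∸_; _⊔_; _≤_; _<_; s≤s; NonZero)
open import Data.Nat.DivMod using (_%_; _mod_; [m+kn]%n≡m%n; m<n⇒m%n≡m)
open import Data.Nat.Properties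
  using ( ≤-refl; ≤-trans; m≤m⊔n; m≤n⊔m; m≤m+n; m≤n+m; n≤1+n; ≰⇒>; _≤?_
        ; m∸n+n≡m; m+n≤o⇒m≤o∸n; m+[n∸m]≡n; m≤m*n; +-suc; +-identityʳ)
open import Data.Product using (_,_; proj₁; proj₂; ∃)
open import Data.Sum using (_⊎_; inj₁; inj₂)
open import Data.Unit using (tt) renaming (⊤ to Unit)
open import Data.Vec using (tabulate)
open import Data.Vec.Properties using ([]=⇒lookup; lookup⇒[]=; lookup∘tabulate)
open import Function.Bundles using (mk⇔; Equivalence)
open import Induction.WellFounded using (module All)
open import Relation.Nullary using (¬_; Dec; yes; no; does; contradiction)
open import Relation.Nullary.Decidable using (dec-true; dec-false; decidable-stable)
open import Relation.Binary.PropositionalEquality using (_≡_; _≢_; refl; sym; trans; cong; subst; module ≡-Reasoning)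

opponent-involutive : ∀ σ → opponent (opponent σ) ≡ σ
opponent-involutive Red  = refl
opponent-involutive Blue = refl

opponent-≢ : ∀ σ → opponent σ ≢ σ
opponent-≢ Red  ()
opponent-≢ Blue ()

≢⇒≡opponent : ∀ {τ σ} → τ ≢ σ → τ ≡ opponent σ
≢⇒≡opponent {Red}  {Red}  τ≢σ = ⊥-elim (τ≢σ refl)
≢⇒≡opponent {Red}  {Blue} _   = refl
≢⇒≡opponent {Blue} {Red}  _   = refl
≢⇒≡opponent {Blue} {Blue} τ≢σ = ⊥-elim (τ≢σ refl)

uniformBound : ∀ {m} (R : Fin m → ℕ → Set) → (∀ w {a b} → a ≤ b → R w a → R w b) →
               (∀ w → ∃ (R w)) → ∃ λ K → ∀ w → R w K
uniformBound {zero}  R mono bounds = 0 , λ ()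
uniformBound {suc m} R mono bounds
  with bounds zero | uniformBound (λ w → R (suc w)) (λ w → mono (suc w)) (λ w → bounds (suc w))
... | a , ra | b , rb = a ⊔ b , λ { zero → mono zero (m≤m⊔n a b) ra ; (suc w) → mono (suc w) (m≤n⊔m a b) (rb w) }

+-mod-surjective : ∀ n .{{_ : NonZero n}} c (d : Fin n) → ∃ λ k → (c + k) mod n ≡ d
+-mod-surjective n c d = k , toℕ-injective (begin
    toℕ ((c + k) mod n)    ≡⟨ toℕ-fromℕ< _ ⟩
    (c + k) % n            ≡⟨ cong (_% n) (m+[n∸m]≡n (≤-trans (m≤m*n c n) (m≤n+m (c * n) (toℕ d)))) ⟩
    (toℕ d + c * n) % n    ≡⟨ [m+kn]%n≡m%n (toℕ d) c n ⟩
    toℕ d % n              ≡⟨ m<n⇒m%n≡m (toℕ<n d) ⟩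
    toℕ d                  ∎)
  where open ≡-Reasoning
        k : ℕ
        k = toℕ d + c * n ∸ c

module Determinacy (em : ExcludedMiddle 0ℓ) {n : ℕ} (G : MullerGame n) where
  open MullerGame G

  dne : ∀ {P : Set} → ¬ ¬ P → P
  dne = decidable-stable em

  leastWitness : (P : ℕ → Set) → ∀ {k} → P k → Σ ℕ λ j → P j × (∀ i → i < j → ¬ P i)
  leastWitness P {zero} p = zero , p , λ i ()
  leastWitness P {suc k} p with em {P zero}
  ... | yes p₀ = zero , p₀ , λ i ()
  ... | no ¬p₀ with leastWitness (λ i → P (suc i)) p
  ...   | j , pj , least = suc j , pj , λ { zero _ → ¬p₀ ; (suc i) (s≤s i<j) → least i i<j }

  ⟦_⟧ : (Fin n → Set) → Subset n
  ⟦ P ⟧ = tabulate (λ v → does (em {P v}))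

  ∈⟦⟧⁻ : ∀ {P v} → v ∈ ⟦ P ⟧ → P v
  ∈⟦⟧⁻ {P} {v} v∈ with em {P v} | trans (sym (lookup∘tabulate (λ u → does (em {P u})) v)) ([]=⇒lookup v∈)
  ... | yes p | _  = p
  ... | no _  | ()

  ∈⟦⟧⁺ : ∀ {P v} → P v → v ∈ ⟦ P ⟧
  ∈⟦⟧⁺ {P} {v} p = lookup⇒[]= v ⟦ P ⟧ (trans (lookup∘tabulate (λ u → does (em {P u})) v) (dec-true (em {P v}) p))

  ⊆∧≢⇒⊂ : ∀ {X S : Subset n} → X ⊆ S → X ≢ S → X ⊂ S
  ⊆∧≢⇒⊂ {X} {S} X⊆S X≢S =
    X⊆S , dne λ ¬missing → X≢S (⊆-antisym X⊆S λ {x} x∈S → dne λ x∉X → ¬missing (x , x∈S , x∉X))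

  InR-opponent⇒¬InR : ∀ σ {S} → InR G (opponent σ) S → ¬ InR G σ S
  InR-opponent⇒¬InR Red  r̄ r = r̄ r
  InR-opponent⇒¬InR Blue r̄ r = r r̄

  ¬InR⇒InR-opponent : ∀ σ {S} → ¬ InR G σ S → InR G (opponent σ) S
  ¬InR⇒InR-opponent Red  ¬r = ¬r
  ¬InR⇒InR-opponent Blue ¬r = dne ¬r

  -- Indexing by i + t (not t + i) makes shift t p (suc i) reduce to p (suc (i + t)).
  shift : ℕ → (ℕ → Fin n) → ℕ → Fin n
  shift t p i = p (i + t)

  InfOften-shift⁻ : ∀ {p t v} → InfOften G (shift t p) v → InfOften G p v
  InfOften-shift⁻ {t = t} often m with often m
  ... | k , m≤k , hit = k + t , ≤-trans m≤k (m≤m+n k t) , hit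

  InfOften-shift⁺ : ∀ {p t v} → InfOften G p v → InfOften G (shift t p) v
  InfOften-shift⁺ {p} {t} often m with often (m + t)
  ... | k , m+t≤k , hit = k ∸ t , m+n≤o⇒m≤o∸n m m+t≤k , trans (cong p (m∸n+n≡m (≤-trans (m≤n+m t m) m+t≤k))) hit

  WinsPlay-shift : ∀ {σ p} t → WinsPlay G σ (shift t p) → WinsPlay G σ p
  WinsPlay-shift t (I , isInf , r) =
    I , (λ v → mk⇔ (λ v∈I → InfOften-shift⁻ (Equivalence.to (isInf v) v∈I))
                   (λ often → Equivalence.from (isInf v) (InfOften-shift⁺ often))) , r

  WinsPlay-exclusive : ∀ σ {p} → WinsPlay G σ p → ¬ WinsPlay G (opponent σ) p
  WinsPlay-exclusive σ (I , isInf , r) (I′ , isInf′ , r̄) = InR-opponent⇒¬InR σ r̄ (subst (InR G σ) I≡I′ r)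
    where
      I≡I′ : I ≡ I′
      I≡I′ = ⊆-antisym (λ {v} v∈ → Equivalence.from (isInf′ v) (Equivalence.to (isInf v) v∈))
                       (λ {v} v∈ → Equivalence.from (isInf v) (Equivalence.to (isInf′ v) v∈))

  record MemoryStrategy (σ : Player) : Set₁ where
    field
      Memory  : Set
      initial : Memory
      update  : Memory → Fin n → Memory
      choose  : Memory → (v : Fin n) → owner v ≡ σ → Fin n

    run : Memory → (ℕ → Fin n) → ℕ → Memory
    run m p zero    = m
    run m p (suc i) = update (run m p i) (p i)

    Follows : Memory → (ℕ → Fin n) → Set
    Follows m p = ∀ i (o : owner (p i) ≡ σ) → p (suc i) ≡ choose (run m p i) (p i) o

    KeepsIn : Subset n → Set
    KeepsIn S = ∀ m v → v ∈ S → (o : owner v ≡ σ) → E v (choose m v o) × choose m v o ∈ S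

    run-shift : ∀ m p t i → run m p (i + t) ≡ run (run m p t) (shift t p) i
    run-shift m p t zero    = refl
    run-shift m p t (suc i) = cong (λ m′ → update m′ (p (i + t))) (run-shift m p t i)

    Follows-shift : ∀ m p t →
      (∀ i (o : owner (p (i + t)) ≡ σ) → p (suc (i + t)) ≡ choose (run m p (i + t)) (p (i + t)) o) →
      Follows (run m p t) (shift t p)
    Follows-shift m p t follows i o = trans (follows i o) (cong (λ m′ → choose m′ (p (i + t)) o) (run-shift m p t i))

  open MemoryStrategy

  run-map : ∀ {σ τ} (𝕄 : MemoryStrategy σ) (𝕄′ : MemoryStrategy τ) (π : Memory 𝕄 → Memory 𝕄′) →
            (∀ m v → π (update 𝕄 m v) ≡ update 𝕄′ (π m) v) →
            ∀ m p i → π (run 𝕄 m p i) ≡ run 𝕄′ (π m) p i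
  run-map 𝕄 𝕄′ π hom m p zero    = refl
  run-map 𝕄 𝕄′ π hom m p (suc i) = trans (hom _ _) (cong (λ m′ → update 𝕄′ m′ (p i)) (run-map 𝕄 𝕄′ π hom m p i))

  -- Winning from every memory state is what lets these strategies be restarted mid-play.
  record WinsOn (σ : Player) (S : Subset n) : Set₁ where
    field
      strategy : MemoryStrategy σ
      keepsIn  : KeepsIn strategy S
      wins     : ∀ m p → IsPlay G p → (∀ i → p i ∈ S) → Follows strategy m p → WinsPlay G σ p

  winsOn-empty : ∀ {σ S} → Empty S → WinsOn σ S
  winsOn-empty S-empty = record
    { strategy = record { Memory = Unit ; initial = tt ; update = λ _ _ → tt ; choose = λ _ v _ → v }
    ; keepsIn  = λ _ v v∈S _ → ⊥-elim (S-empty (v , v∈S))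
    ; wins     = λ _ p _ p∈S _ → ⊥-elim (S-empty (p 0 , p∈S 0)) }

  IsSubgame : Subset n → Set
  IsSubgame S = ∀ v → v ∈ S → Σ (Fin n) λ w → E v w × w ∈ S

  ClosedIn : Player → Subset n → Subset n → Set
  ClosedIn τ S Z = ∀ z → z ∈ Z → owner z ≡ τ → ∀ y → E z y → y ∈ S → y ∈ Z

  successorIn : ∀ {S} → IsSubgame S → ∀ v → Σ (Fin n) λ w → v ∈ S → E v w × w ∈ S
  successorIn {S} sub v with em {v ∈ S}
  ... | yes v∈S = proj₁ (sub v v∈S) , λ _ → proj₂ (sub v v∈S)
  ... | no v∉S  = v , λ v∈S → contradiction v∈S v∉S

  trap-closed : ∀ {τ S X} → IsTrapIn G τ S X → ClosedIn τ S X
  trap-closed (_ , _ , moves) x x∈X = proj₁ (moves x x∈X)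

  trap-isSubgame : ∀ {τ S X} → IsSubgame S → IsTrapIn G τ S X → IsSubgame X
  trap-isSubgame {τ} sub trap@(_ , X⊆S , moves) x x∈X with em {owner x ≡ τ} | sub x (X⊆S x∈X)
  ... | yes o  | w , e , w∈S = w , e , trap-closed trap x x∈X o w e w∈S
  ... | no ¬o  | _           = proj₂ (moves x x∈X) ¬o

  self-trap : ∀ {τ S} → Nonempty S → IsSubgame S → IsTrapIn G τ S S
  self-trap S-nonempty sub = S-nonempty , (λ x∈S → x∈S) , λ x x∈S → (λ _ _ _ y∈S → y∈S) , λ _ → sub x x∈S

  trap-lift : ∀ {τ S Z X} → Z ⊆ S → ClosedIn τ S Z → IsTrapIn G τ Z X → IsTrapIn G τ S X
  trap-lift Z⊆S closed trap@(X-nonempty , X⊆Z , moves) =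
    X-nonempty , (λ x∈X → Z⊆S (X⊆Z x∈X)) ,
    λ x x∈X → (λ o y e y∈S → trap-closed trap x x∈X o y e (closed x (X⊆Z x∈X) o y e y∈S)) , proj₂ (moves x x∈X)

  ¬TDWin-restrict : ∀ σ {S Z} → Z ⊆ S → ClosedIn σ S Z → ¬ TDWin G (opponent σ) S → ¬ TDWin G (opponent σ) Z
  ¬TDWin-restrict σ {S} {Z} Z⊆S closed lose (move X (trap , r) answers) =
    lose (move X (trap-lift Z⊆S closed′ trap , r) answers)
    where closed′ : ClosedIn (opponent (opponent σ)) S Z
          closed′ = subst (λ τ → ClosedIn τ S Z) (sym (opponent-involutive σ)) closed

  winningMove⇒¬TDWin : ∀ σ {X} → (∀ Y → LegalSecond G σ X Y → TDWin G σ Y) → ¬ TDWin G (opponent σ) X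
  winningMove⇒¬TDWin Red  answers (move Y legal answers′) with answers Y legal
  ... | move X′ legal′ answers″ = winningMove⇒¬TDWin Red answers″ (answers′ X′ legal′)
  winningMove⇒¬TDWin Blue answers (move Y legal answers′) with answers Y legal
  ... | move X′ legal′ answers″ = winningMove⇒¬TDWin Blue answers″ (answers′ X′ legal′)

  prefix-suc : ∀ p i → prefix G p (suc i) ≡ prefix G p i ∷ʳ p i
  prefix-suc p i = trans (cong (map p) (sym (upTo-∷ʳ i))) (map-++ p (upTo i) [ i ])

  module _ {σ S} (W : WinsOn σ S) where
    open WinsOn W

    toStrategy : Strategy G σ
    toStrategy h v o with em {v ∈ S}
    ... | yes v∈S = choose strategy (foldl (update strategy) (initial strategy) h) v o , proj₁ (keepsIn _ v v∈S o)
    ... | no _    = total v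

    toStrategy-∈ : ∀ h v o → v ∈ S → proj₁ (toStrategy h v o) ≡ choose strategy (foldl (update strategy) (initial strategy) h) v o
    toStrategy-∈ h v o v∈S with em {v ∈ S}
    ... | yes _   = refl
    ... | no v∉S  = contradiction v∈S v∉S

    foldl-prefix : ∀ m p i → foldl (update strategy) m (prefix G p i) ≡ run strategy m p i
    foldl-prefix m p zero    = refl
    foldl-prefix m p (suc i) = begin
      foldl (update strategy) m (prefix G p (suc i))
        ≡⟨ cong (foldl (update strategy) m) (prefix-suc p i) ⟩
      foldl (update strategy) m (prefix G p i ∷ʳ p i)
        ≡⟨ foldl-∷ʳ (update strategy) m (p i) (prefix G p i) ⟩
      update strategy (foldl (update strategy) m (prefix G p i)) (p i)
        ≡⟨ cong (λ m′ → update strategy m′ (p i)) (foldl-prefix m p i) ⟩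
      run strategy m p (suc i)
        ∎
      where open ≡-Reasoning

    toStrategy-wins : ClosedIn (opponent σ) ⊤ S → ∀ v → v ∈ S → WinningStrategyFrom G σ toStrategy v
    toStrategy-wins closed v v∈S p refl isPlay follows = wins (initial strategy) p isPlay staysIn followsMemory
      where
        followsMemory′ : ∀ i o → p i ∈ S → p (suc i) ≡ choose strategy (run strategy (initial strategy) p i) (p i) o
        followsMemory′ i o p∈S = trans (follows i o)
          (trans (toStrategy-∈ _ _ o p∈S) (cong (λ m → choose strategy m (p i) o) (foldl-prefix _ p i)))

        staysIn : ∀ i → p i ∈ S
        staysIn zero = v∈S
        staysIn (suc i) with em {owner (p i) ≡ σ}
        ... | yes o = subst (_∈ S) (sym (followsMemory′ i o (staysIn i))) (proj₂ (keepsIn _ (p i) (staysIn i) o))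
        ... | no ¬o = closed (p i) (staysIn i) (≢⇒≡opponent ¬o) (p (suc i)) (isPlay i) ∈⊤

        followsMemory : Follows strategy (initial strategy) p
        followsMemory i o = followsMemory′ i o (staysIn i)

  module Outcome {σ} (str : Strategy G σ) (str̄ : Strategy G (opponent σ)) (v₀ : Fin n) where
    next : List (Fin n) → (v : Fin n) → Dec (owner v ≡ σ) → Fin n
    next h v (yes o) = proj₁ (str h v o)
    next h v (no ¬o) = proj₁ (str̄ h v (≢⇒≡opponent ¬o))

    next-edge : ∀ h v d → E v (next h v d)
    next-edge h v (yes o) = proj₂ (str h v o)
    next-edge h v (no ¬o) = proj₂ (str̄ h v (≢⇒≡opponent ¬o))

    next-σ : ∀ h v o d → next h v d ≡ proj₁ (str h v o)
    next-σ h v o (yes o′) = cong (λ o″ → proj₁ (str h v o″)) (uip o′ o)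
    next-σ h v o (no ¬o)  = contradiction o ¬o

    next-σ̄ : ∀ h v ō d → next h v d ≡ proj₁ (str̄ h v ō)
    next-σ̄ h v ō (yes o) = contradiction (trans (sym ō) o) (opponent-≢ σ)
    next-σ̄ h v ō (no ¬o) = cong (λ o″ → proj₁ (str̄ h v o″)) (uip (≢⇒≡opponent ¬o) ō)

    state : ℕ → List (Fin n) × Fin n
    play : ℕ → Fin n
    state zero    = [] , v₀
    state (suc i) = proj₁ (state i) ∷ʳ play i , next (proj₁ (state i)) (play i) (em {owner (play i) ≡ σ})

    play i = proj₂ (state i)

    history : ∀ i → proj₁ (state i) ≡ prefix G play i
    history zero    = refl
    history (suc i) = trans (cong (_∷ʳ play i) (history i)) (sym (prefix-suc play i))

    isPlay : IsPlay G play
    isPlay i = next-edge (proj₁ (state i)) (play i) (em {owner (play i) ≡ σ})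

    follows : ConsistentWith G σ str play
    follows i o = trans (next-σ _ (play i) o (em {owner (play i) ≡ σ})) (cong (λ h → proj₁ (str h (play i) o)) (history i))

    follows̄ : ConsistentWith G (opponent σ) str̄ play
    follows̄ i ō = trans (next-σ̄ _ (play i) ō (em {owner (play i) ≡ σ})) (cong (λ h → proj₁ (str̄ h (play i) ō)) (history i))

  module Attractor (σ : Player) (S : Subset n) (T : Fin n → Set) where
    data Att : ℕ → Fin n → Set where
      target : ∀ {k v} → T v → Att k v
      pull   : ∀ {k v w} → v ∈ S → owner v ≡ σ → E v w → w ∈ S → Att k w → Att (suc k) v
      force  : ∀ {k v} → v ∈ S → owner v ≢ σ → (∀ w → E v w → w ∈ S → Att k w) → Att (suc k) v

    Attr : Fin n → Set
    Attr v = ∃ λ k → Att k v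

    Att-mono : ∀ {k k′ v} → k ≤ k′ → Att k v → Att k′ v
    Att-mono _          (target t)                = target t
    Att-mono (s≤s k≤k′) (pull v∈S o e w∈S attr)   = pull v∈S o e w∈S (Att-mono k≤k′ attr)
    Att-mono (s≤s k≤k′) (force v∈S ¬o attrs)      = force v∈S ¬o λ w e w∈S → Att-mono k≤k′ (attrs w e w∈S)

    -- The successor taken from a derivation of least rank works for every rank of v.
    descent : ∀ v → owner v ≡ σ → Attr v → ¬ T v →
              Σ (Fin n) λ w → E v w × w ∈ S × (∀ k → Att (suc k) v → Att k w)
    descent v o (_ , attr) ¬t with leastWitness (λ j → Att j v) attr
    ... | _     , target t                     , _     = contradiction t ¬t
    ... | suc j , force _ ¬o _                 , _     = contradiction o ¬o
    ... | suc j , pull {w = w} _ _ e w∈S attrʷ , least = w , e , w∈S , λ k attr′ → Att-mono (j≤k k attr′) attrʷ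
      where
        j≤k : ∀ k → Att (suc k) v → j ≤ k
        j≤k k attr′ with j ≤? k
        ... | yes j≤k = j≤k
        ... | no  j≰k = contradiction attr′ (least (suc k) (s≤s (≰⇒> j≰k)))

    attMove : ∀ v → owner v ≡ σ → Fin n
    attMove v o with em {Attr v × ¬ T v}
    ... | yes (attr , ¬t) = proj₁ (descent v o attr ¬t)
    ... | no _            = v

    attMove-descends : ∀ v o → Attr v → ¬ T v →
                       E v (attMove v o) × attMove v o ∈ S × (∀ k → Att (suc k) v → Att k (attMove v o))
    attMove-descends v o attr ¬t with em {Attr v × ¬ T v}
    ... | yes (attr′ , ¬t′) = proj₂ (descent v o attr′ ¬t′)
    ... | no ¬both          = contradiction (attr , ¬t) ¬both

    attract : ∀ {q} → IsPlay G q → (∀ i → q i ∈ S) →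
              (∀ i (o : owner (q i) ≡ σ) → Attr (q i) → ¬ T (q i) → q (suc i) ≡ attMove (q i) o) →
              ∀ k i → Att k (q i) → ∃ λ j → T (q j)
    attract isPlay q∈S follows k i (target t) = i , t
    attract {q} isPlay q∈S follows (suc k) i attr@(pull _ o _ _ _) with em {T (q i)}
    ... | yes t = i , t
    ... | no ¬t = attract isPlay q∈S follows k (suc i)
                    (subst (Att k) (sym (follows i o (_ , attr) ¬t))
                      (proj₂ (proj₂ (attMove-descends (q i) o (_ , attr) ¬t)) k attr))
    attract {q} isPlay q∈S follows (suc k) i (force _ _ attrs) =
      attract isPlay q∈S follows k (suc i) (attrs (q (suc i)) (isPlay i) (q∈S (suc i)))

    Safe : Subset n
    Safe = ⟦ (λ v → v ∈ S × ¬ Attr v) ⟧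

    Safe⊆S : Safe ⊆ S
    Safe⊆S v∈Safe = proj₁ (∈⟦⟧⁻ v∈Safe)

    Safe-closed : ClosedIn σ S Safe
    Safe-closed v v∈Safe o w e w∈S =
      ∈⟦⟧⁺ (w∈S , λ (k , attr) → proj₂ (∈⟦⟧⁻ v∈Safe) (suc k , pull (Safe⊆S v∈Safe) o e w∈S attr))

    escape : ∀ v → v ∈ S → owner v ≢ σ → ¬ Attr v → Σ (Fin n) λ w → E v w × w ∈ S × ¬ Attr w
    escape v v∈S ¬o ¬attr = dne λ ¬escape →
      let K , attrs = uniformBound (λ w K → E v w → w ∈ S → Att K w)
                                   (λ w k≤k′ attrs e w∈S → Att-mono k≤k′ (attrs e w∈S))
                                   (λ w → rank w ¬escape)
      in ¬attr (suc K , force v∈S ¬o λ w → attrs w)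
      where
        rank : ∀ w → ¬ (Σ (Fin n) λ w → E v w × w ∈ S × ¬ Attr w) → ∃ λ K → E v w → w ∈ S → Att K w
        rank w ¬escape with em {E v w × w ∈ S}
        ... | no ¬edge = 0 , λ e w∈S → contradiction (e , w∈S) ¬edge
        ... | yes (e , w∈S) with em {Attr w}
        ...   | yes (K , attr) = K , λ _ _ → attr
        ...   | no ¬attrʷ      = contradiction (w , e , w∈S , ¬attrʷ) ¬escape

    Safe-isSubgame : IsSubgame S → IsSubgame Safe
    Safe-isSubgame sub v v∈Safe with em {owner v ≡ σ} | ∈⟦⟧⁻ v∈Safe
    ... | yes o  | v∈S , _     = let w , e , w∈S = sub v v∈S in w , e , Safe-closed v v∈Safe o w e w∈S
    ... | no ¬o  | v∈S , ¬attr = let w , e , w∈S , ¬attrʷ = escape v v∈S ¬o ¬attr in w , e , ∈⟦⟧⁺ (w∈S , ¬attrʷ)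

    Safe⊂S : ∀ {x} → T x → x ∈ S → Safe ⊂ S
    Safe⊂S t x∈S = Safe⊆S , _ , x∈S , λ x∈Safe → proj₂ (∈⟦⟧⁻ x∈Safe) (0 , target t)

    module AttractOrPlay (W : WinsOn σ Safe) where
      open WinsOn W using (strategy; keepsIn; wins)

      attractOrPlay : Memory strategy → (v : Fin n) → owner v ≡ σ → Fin n
      attractOrPlay m v o = if does (em {Attr v}) then attMove v o else choose strategy m v o

      attractOrPlay-Attr : ∀ m v o → Attr v → attractOrPlay m v o ≡ attMove v o
      attractOrPlay-Attr m v o attr rewrite dec-true (em {Attr v}) attr = refl

      attractOrPlay-¬Attr : ∀ m v o → ¬ Attr v → attractOrPlay m v o ≡ choose strategy m v o
      attractOrPlay-¬Attr m v o ¬attr rewrite dec-false (em {Attr v}) ¬attr = refl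

      attractOrPlay-keepsIn : ∀ m v → v ∈ S → ¬ T v → (o : owner v ≡ σ) →
                              E v (attractOrPlay m v o) × attractOrPlay m v o ∈ S
      attractOrPlay-keepsIn m v v∈S ¬t o with em {Attr v}
      ... | yes attr = let e , w∈S , _ = attMove-descends v o attr ¬t in e , w∈S
      ... | no ¬attr = let e , w∈Safe = keepsIn m v (∈⟦⟧⁺ (v∈S , ¬attr)) o in e , Safe⊆S w∈Safe

      reachOrWin : ∀ m q → IsPlay G q → (∀ i → q i ∈ S) →
                   (∀ i (o : owner (q i) ≡ σ) → ¬ T (q i) → q (suc i) ≡ attractOrPlay (run strategy m q i) (q i) o) →
                   (∃ λ i → T (q i)) ⊎ WinsPlay G σ q
      reachOrWin m q isPlay q∈S follows with em {∃ λ i → Attr (q i)}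
      ... | yes (i , k , attr) = inj₁ (attract isPlay q∈S
              (λ i o attr ¬t → trans (follows i o ¬t) (attractOrPlay-Attr _ (q i) o attr)) k i attr)
      ... | no never = inj₂ (wins m q isPlay (λ i → ∈⟦⟧⁺ (q∈S i , λ attr → never (i , attr)))
              λ i o → trans (follows i o λ t → never (i , 0 , target t)) (attractOrPlay-¬Attr _ (q i) o λ attr → never (i , attr)))

  module InductionStep (σ : Player) {S : Subset n}
              (IH : ∀ {Z} → Z ⊂ S → IsSubgame Z → ¬ TDWin G (opponent σ) Z → WinsOn σ Z)
              (sub : IsSubgame S) (lose : ¬ TDWin G (opponent σ) S) where

    safeWins : (T : Fin n → Set) → (∀ {v} → T v → v ∈ S) → ∃ T → WinsOn σ (Attractor.Safe σ S T)
    safeWins T T⊆S (_ , t) = IH (Safe⊂S t (T⊆S t)) (Safe-isSubgame sub) (¬TDWin-restrict σ Safe⊆S Safe-closed lose)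
      where open Attractor σ S T

    module TrapCase (S-nonempty : Nonempty S) (¬r : ¬ InR G σ S) where
      trapAnswer : Σ (Subset n) λ Y → LegalSecond G (opponent σ) S Y × ¬ TDWin G (opponent σ) Y
      trapAnswer = dne λ none → lose (move S (self-trap S-nonempty sub , ¬InR⇒InR-opponent σ ¬r)
                                            λ Y legal → dne λ lose′ → none (Y , legal , lose′))

      Y : Subset n
      Y = proj₁ trapAnswer

      Y-trap : IsTrapIn G (opponent σ) S Y
      Y-trap = proj₁ (proj₁ (proj₂ trapAnswer))

      Y⊆S : Y ⊆ S
      Y⊆S = proj₁ (proj₂ Y-trap)

      Y∈R : InR G σ Y
      Y∈R = subst (λ τ → InR G τ Y) (opponent-involutive σ) (proj₂ (proj₁ (proj₂ trapAnswer)))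

      onY : WinsOn σ Y
      onY = IH (⊆∧≢⇒⊂ Y⊆S λ Y≡S → ¬r (subst (InR G σ) Y≡S Y∈R)) (trap-isSubgame sub Y-trap) (proj₂ (proj₂ trapAnswer))

      open Attractor σ S (_∈ Y)

      onSafe : WinsOn σ Safe
      onSafe = safeWins (_∈ Y) Y⊆S (proj₁ Y-trap)

      open AttractOrPlay onSafe
      module 𝕐 = WinsOn onY
      module 𝕊 = WinsOn onSafe

      combined : MemoryStrategy σ
      combined = record
        { Memory  = Memory 𝕐.strategy × Memory 𝕊.strategy
        ; initial = initial 𝕐.strategy , initial 𝕊.strategy
        ; update  = λ (a , b) v → update 𝕐.strategy a v , update 𝕊.strategy b v
        ; choose  = λ (a , b) v o → if does (em {v ∈ Y}) then choose 𝕐.strategy a v o else attractOrPlay b v o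
        }

      choose-∈Y : ∀ m v o → v ∈ Y → choose combined m v o ≡ choose 𝕐.strategy (proj₁ m) v o
      choose-∈Y m v o v∈Y rewrite dec-true (em {v ∈ Y}) v∈Y = refl

      choose-∉Y : ∀ m v o → v ∉ Y → choose combined m v o ≡ attractOrPlay (proj₂ m) v o
      choose-∉Y m v o v∉Y rewrite dec-false (em {v ∈ Y}) v∉Y = refl

      combined-keepsIn : KeepsIn combined S
      combined-keepsIn m v v∈S o with em {v ∈ Y}
      ... | yes v∈Y = let e , w∈Y = 𝕐.keepsIn (proj₁ m) v v∈Y o in e , Y⊆S w∈Y
      ... | no v∉Y  = attractOrPlay-keepsIn (proj₂ m) v v∈S v∉Y o

      combined-wins : ∀ m p → IsPlay G p → (∀ i → p i ∈ S) → Follows combined m p → WinsPlay G σ p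
      combined-wins m p isPlay p∈S follows with reachOrWin (proj₂ m) p isPlay p∈S followsOutsideY
        where
          followsOutsideY : ∀ i o → p i ∉ Y → p (suc i) ≡ attractOrPlay (run 𝕊.strategy (proj₂ m) p i) (p i) o
          followsOutsideY i o p∉Y = trans (follows i o) (trans (choose-∉Y _ (p i) o p∉Y)
            (cong (λ b → attractOrPlay b (p i) o) (run-map combined 𝕊.strategy proj₂ (λ _ _ → refl) m p i)))
      ... | inj₂ won        = won
      ... | inj₁ (t , p∈Y) = WinsPlay-shift {σ} t (𝕐.wins (run 𝕐.strategy (proj₁ m) p t) (shift t p) (λ i → isPlay (i + t)) inY
                                (Follows-shift 𝕐.strategy (proj₁ m) p t λ i o → followsInY i o (inY i)))
        where
          followsInY : ∀ i o → p (i + t) ∈ Y →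
                       p (suc (i + t)) ≡ choose 𝕐.strategy (run 𝕐.strategy (proj₁ m) p (i + t)) (p (i + t)) o
          followsInY i o p∈Y′ = trans (follows (i + t) o) (trans (choose-∈Y _ _ o p∈Y′)
            (cong (λ a → choose 𝕐.strategy a (p (i + t)) o) (run-map combined 𝕐.strategy proj₁ (λ _ _ → refl) m p (i + t))))

          inY : ∀ i → p (i + t) ∈ Y
          inY zero    = p∈Y
          inY (suc i) with em {owner (p (i + t)) ≡ σ}
          ... | yes o = subst (_∈ Y) (sym (followsInY i o (inY i))) (proj₂ (𝕐.keepsIn _ _ (inY i) o))
          ... | no ¬o = trap-closed Y-trap _ (inY i) (≢⇒≡opponent ¬o) _ (isPlay (i + t)) (p∈S (suc (i + t)))

      trapCase : WinsOn σ S
      trapCase = record { strategy = combined ; keepsIn = combined-keepsIn ; wins = combined-wins }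

    module CycleCase {x : Fin n} (x∈S : x ∈ S) (S∈R : InR G σ S) where
      instance
        n≢0 : NonZero n
        n≢0 = nonZeroIndex x

      -- A phase aiming at a vertex d ∉ S ends at once.
      Target : Fin n → Fin n → Set
      Target d v = v ∈ S × (d ∈ S → v ≡ d)

      target-nonempty : ∀ d → ∃ (Target d)
      target-nonempty d with em {d ∈ S}
      ... | yes d∈S = d , d∈S , λ _ → refl
      ... | no d∉S  = x , x∈S , λ d∈S → contradiction d∈S d∉S

      module Phase (d : Fin n) = Attractor σ S (Target d)

      onSafe : (d : Fin n) → WinsOn σ (Phase.Safe d)
      onSafe d = safeWins (Target d) proj₁ (target-nonempty d)

      𝕊 : Fin n → MemoryStrategy σ
      𝕊 d = WinsOn.strategy (onSafe d)

      module AOP (d : Fin n) = Phase.AttractOrPlay d (onSafe d)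

      -- The counter c records how many phases have ended; the current phase aims at c mod n.
      cycling : MemoryStrategy σ
      cycling = record
        { Memory  = ℕ × ((d : Fin n) → Memory (𝕊 d))
        ; initial = 0 , λ d → initial (𝕊 d)
        ; update  = λ (c , ms) v → (if does (em {Target (c mod n) v}) then suc c else c) , λ d → update (𝕊 d) (ms d) v
        ; choose  = λ (c , ms) v o → if does (em {Target (c mod n) v}) then proj₁ (successorIn sub v)
                                     else AOP.attractOrPlay (c mod n) (ms (c mod n)) v o
        }

      cycling-keepsIn : KeepsIn cycling S
      cycling-keepsIn (c , ms) v v∈S o with em {Target (c mod n) v}
      ... | yes _ = proj₂ (successorIn sub v) v∈S
      ... | no ¬t = AOP.attractOrPlay-keepsIn (c mod n) (ms (c mod n)) v v∈S ¬t o

      choose-¬Target : ∀ s v o → ¬ Target (proj₁ s mod n) v →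
                       choose cycling s v o ≡ AOP.attractOrPlay (proj₁ s mod n) (proj₂ s (proj₁ s mod n)) v o
      choose-¬Target (c , ms) v o ¬t rewrite dec-false (em {Target (c mod n) v}) ¬t = refl

      module _ (m₀ : Memory cycling) (p : ℕ → Fin n) (isPlay : IsPlay G p) (p∈S : ∀ i → p i ∈ S)
               (follows : Follows cycling m₀ p) where
        counter : ℕ → ℕ
        counter t = proj₁ (run cycling m₀ p t)

        Advances : ℕ → Set
        Advances t = Target (counter t mod n) (p t)

        counter-advance : ∀ t → Advances t → counter (suc t) ≡ suc (counter t)
        counter-advance t adv rewrite dec-true (em {Advances t}) adv = refl

        counter-stay : ∀ t → ¬ Advances t → counter (suc t) ≡ counter t
        counter-stay t ¬adv rewrite dec-false (em {Advances t}) ¬adv = refl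

        firstAdvance : ∀ d t → Advances (d + t) → ∃ λ t′ → t ≤ t′ × Advances t′ × counter t′ ≡ counter t
        firstAdvance d t adv with em {Advances t}
        firstAdvance d       t adv | yes adv′ = t , ≤-refl , adv′ , refl
        firstAdvance zero    t adv | no ¬adv  = contradiction adv ¬adv
        firstAdvance (suc d) t adv | no ¬adv  with firstAdvance d (suc t) (subst Advances (sym (+-suc d t)) adv)
        ... | t′ , t<t′ , adv′ , same = t′ , ≤-trans (n≤1+n t) t<t′ , adv′ , trans same (counter-stay t ¬adv)

        module Often (often : ∀ t → ∃ λ t′ → t ≤ t′ × Advances t′) where
          nextAdvance : ∀ t → ∃ λ t′ → t ≤ t′ × Advances t′ × counter t′ ≡ counter t
          nextAdvance t with often t
          ... | t′ , t≤t′ , adv = firstAdvance (t′ ∸ t) t (subst Advances (sym (m∸n+n≡m t≤t′)) adv)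

          counterReaches : ∀ k t → ∃ λ t′ → t ≤ t′ × counter t′ ≡ counter t + k
          counterReaches zero    t = t , ≤-refl , sym (+-identityʳ (counter t))
          counterReaches (suc k) t with counterReaches k t
          ... | t₁ , t≤t₁ , reached with nextAdvance t₁
          ...   | t₂ , t₁≤t₂ , adv , same =
            suc t₂ , ≤-trans t≤t₁ (≤-trans t₁≤t₂ (n≤1+n t₂)) ,
            trans (counter-advance t₂ adv) (trans (cong suc (trans same reached)) (sym (+-suc (counter t) k)))

          visitsAll : ∀ v → v ∈ S → InfOften G p v
          visitsAll v v∈S t with +-mod-surjective n (counter t) v
          ... | k , hits with counterReaches k t
          ...   | t₁ , t≤t₁ , reached with nextAdvance t₁
          ...     | t₂ , t₁≤t₂ , adv , same =
            t₂ , ≤-trans t≤t₁ t₁≤t₂ , trans (proj₂ adv (subst (_∈ S) (sym targeted) v∈S)) targeted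
            where targeted : counter t₂ mod n ≡ v
                  targeted = trans (cong (_mod n) (trans same reached)) hits

          S-isInfSet : IsInfSet G p S
          S-isInfSet v = mk⇔ (visitsAll v) λ visited → let k , _ , hit = visited 0 in subst (_∈ S) hit (p∈S k)

        module Stuck (m : ℕ) (never : ∀ i → ¬ Advances (i + m)) where
          stable : ∀ i → counter (i + m) ≡ counter m
          stable zero    = refl
          stable (suc i) = trans (counter-stay (i + m) (never i)) (stable i)

          D : Fin n
          D = counter m mod n

          followsPhase : ∀ i o → ¬ Target D (p (i + m)) →
                         p (suc (i + m)) ≡ AOP.attractOrPlay D (run (𝕊 D) (run (𝕊 D) (proj₂ m₀ D) p m) (shift m p) i) (p (i + m)) o
          followsPhase i o ¬t = begin
            p (suc (i + m))
              ≡⟨ follows (i + m) o ⟩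
            choose cycling s (p (i + m)) o
              ≡⟨ choose-¬Target s (p (i + m)) o (λ t → never i t) ⟩
            AOP.attractOrPlay (counter (i + m) mod n) (proj₂ s (counter (i + m) mod n)) (p (i + m)) o
              ≡⟨ cong (λ c → AOP.attractOrPlay (c mod n) (proj₂ s (c mod n)) (p (i + m)) o) (stable i) ⟩
            AOP.attractOrPlay D (proj₂ s D) (p (i + m)) o
              ≡⟨ cong (λ mᴰ → AOP.attractOrPlay D mᴰ (p (i + m)) o)
                      (trans (run-map cycling (𝕊 D) (λ s′ → proj₂ s′ D) (λ _ _ → refl) m₀ p (i + m))
                             (run-shift (𝕊 D) _ p m i)) ⟩
            AOP.attractOrPlay D (run (𝕊 D) (run (𝕊 D) (proj₂ m₀ D) p m) (shift m p) i) (p (i + m)) o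
              ∎
            where open ≡-Reasoning
                  s = run cycling m₀ p (i + m)

          wins : WinsPlay G σ p
          wins with AOP.reachOrWin D _ (shift m p) (λ i → isPlay (i + m)) (λ i → p∈S (i + m)) followsPhase
          ... | inj₁ (i , t) = contradiction (subst (λ c → Target (c mod n) (p (i + m))) (sym (stable i)) t) (never i)
          ... | inj₂ won     = WinsPlay-shift {σ} m won

        eventuallyStuck : ¬ (∀ t → ∃ λ t′ → t ≤ t′ × Advances t′) → ∃ λ m → ∀ i → ¬ Advances (i + m)
        eventuallyStuck ¬often =
          dne λ ¬stuck → ¬often λ t → dne λ ¬adv → ¬stuck (t , λ i adv → ¬adv (i + t , m≤n+m t i , adv))

        cycling-wins : WinsPlay G σ p
        cycling-wins with em {∀ t → ∃ λ t′ → t ≤ t′ × Advances t′}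
        ... | yes often = S , Often.S-isInfSet often , S∈R
        ... | no ¬often = let m , never = eventuallyStuck ¬often in Stuck.wins m never

      cycleCase : WinsOn σ S
      cycleCase = record { strategy = cycling ; keepsIn = cycling-keepsIn ; wins = cycling-wins }

  winsOn : ∀ σ S → IsSubgame S → ¬ TDWin G (opponent σ) S → WinsOn σ S
  winsOn σ = All.wfRec ⊂-wellFounded (lsuc 0ℓ) (λ S → IsSubgame S → ¬ TDWin G (opponent σ) S → WinsOn σ S) step
    where
      step : ∀ S → (∀ {Z} → Z ⊂ S → IsSubgame Z → ¬ TDWin G (opponent σ) Z → WinsOn σ Z) →
             IsSubgame S → ¬ TDWin G (opponent σ) S → WinsOn σ S
      step S IH sub lose with em {Nonempty S} | em {InR G σ S}
      ... | no S-empty           | _       = winsOn-empty S-empty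
      ... | yes (_ , x∈S)        | yes S∈R = InductionStep.CycleCase.cycleCase σ IH sub lose x∈S S∈R
      ... | yes S-nonempty       | no ¬r   = InductionStep.TrapCase.trapCase σ IH sub lose S-nonempty ¬r

  ⊤-isSubgame : IsSubgame ⊤
  ⊤-isSubgame v _ = proj₁ (total v) , proj₂ (total v) , ∈⊤

  winningFirstMove⊆winningRegion : ∀ σ X → WinningFirstMove G σ ⊤ X → ∀ v → v ∈ X → InWinningRegion G σ v
  winningFirstMove⊆winningRegion σ X ((trap , _) , answers) v v∈X =
    toStrategy onX , toStrategy-wins onX (trap-closed trap) v v∈X
    where onX : WinsOn σ X
          onX = winsOn σ X (trap-isSubgame ⊤-isSubgame trap) (winningMove⇒¬TDWin σ answers)

  TDWin⇒winningRegion : ∀ σ → TDWin G σ ⊤ → Σ (Fin n) (InWinningRegion G σ)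
  TDWin⇒winningRegion σ (move X legal answers) with proj₁ (proj₁ legal)
  ... | x , x∈X = x , winningFirstMove⊆winningRegion σ X (legal , answers) x x∈X

  ¬TDWin⇒opponentWins : ∀ σ → ¬ TDWin G σ ⊤ → WinsOn (opponent σ) ⊤
  ¬TDWin⇒opponentWins σ lose =
    winsOn (opponent σ) ⊤ ⊤-isSubgame (subst (λ τ → ¬ TDWin G τ ⊤) (sym (opponent-involutive σ)) lose)

  winningRegion⇒TDWin : ∀ σ → Σ (Fin n) (InWinningRegion G σ) → TDWin G σ ⊤
  winningRegion⇒TDWin σ (v , str , winning) = dne λ lose →
    let open Outcome str (toStrategy (¬TDWin⇒opponentWins σ lose)) v
    in WinsPlay-exclusive σ (winning play refl isPlay follows)
         (toStrategy-wins (¬TDWin⇒opponentWins σ lose) (λ _ _ _ _ _ _ → ∈⊤) v ∈⊤ play refl isPlay follows̄)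

mainTheorem1 : ExcludedMiddle 0ℓ → {n : ℕ} (G : MullerGame n) (σ : Player) →
    ((Σ (Fin n) (InWinningRegion G σ)) ⇔ TDWin G σ ⊤) ×
    (∀ X → WinningFirstMove G σ ⊤ X → ∀ v → v ∈ X → InWinningRegion G σ v)
mainTheorem1 em G σ =
  mk⇔ (winningRegion⇒TDWin σ) (TDWin⇒winningRegion σ) , winningFirstMove⊆winningRegion σ
  where open Determinacy em G
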